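{- Let $G$ be a simple graph with $\chi(G)\le4$ and $\chi'(G)=\Delta(G)$. Then $\chi''(G)\le\Delta(G)+2$.
   Context: $\chi(G)$ is the chromatic number, $\chi'(G)$ the edge-chromatic number (minimum number of colors in a proper edge-coloring), and $\Delta(G)$ the maximum degree. A total coloring of $G$ colors $V(G)\cup E(G)$ so that any two adjacent vertices, any two edges sharing an endpoint, and any vertex and an edge incident to it receive distinct colors; $\chi''(G)$ is the minimum number of colors in a total coloring. -}

module Defs where

open import Data.Nat using (ℕ; zero; suc; _+_; _⊔_; _≤_)
open import Data.Bool using (Bool; true; false; if_then_else_)
open import Data.Fin using (Fin)
open import Data.List using (List; map; foldr; allFin)
open import Data.Nat.ListAction using (sum)
open import Data.Product using (Σ; _×_; ∃)
open import Relation.Binary.PropositionalEquality using (_≡_; _≢_)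

record Graph : Set where
  field
    n      : ℕ
    adj    : Fin n → Fin n → Bool
    sym    : ∀ u v → adj u v ≡ adj v u
    irrefl : ∀ v → adj v v ≡ false
open Graph public

Adj : (G : Graph) → Fin (n G) → Fin (n G) → Set
Adj G u v = adj G u v ≡ true

degree : (G : Graph) → Fin (n G) → ℕ
degree G v = sum (map (λ u → if adj G v u then 1 else 0) (allFin (n G)))

Δ : Graph → ℕ
Δ G = foldr _⊔_ 0 (map (degree G) (allFin (n G)))

IsVertexColoring : (G : Graph) (k : ℕ) → (Fin (n G) → Fin k) → Set
IsVertexColoring G k c = ∀ u v → Adj G u v → c u ≢ c v

-- an edge coloring is given as a function on ordered pairs; only its values
-- on adjacent pairs matter, and it must be symmetric there (edges are unordered).
IsEdgeColoring : (G : Graph) (k : ℕ) → (Fin (n G) → Fin (n G) → Fin k) → Set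
IsEdgeColoring G k e =
  (∀ u v → Adj G u v → e u v ≡ e v u) ×
  (∀ u v w → Adj G u v → Adj G u w → v ≢ w → e u v ≢ e u w)

IsTotalColoring : (G : Graph) (k : ℕ) →
  (Fin (n G) → Fin k) → (Fin (n G) → Fin (n G) → Fin k) → Set
IsTotalColoring G k c e =
  IsVertexColoring G k c × IsEdgeColoring G k e ×
  (∀ u v → Adj G u v → c u ≢ e u v)

VertexColorable : Graph → ℕ → Set
VertexColorable G k = Σ (Fin (n G) → Fin k) (IsVertexColoring G k)

EdgeColorable : Graph → ℕ → Set
EdgeColorable G k = Σ (Fin (n G) → Fin (n G) → Fin k) (IsEdgeColoring G k)

TotalColorable : Graph → ℕ → Set
TotalColorable G k =
  Σ (Fin (n G) → Fin k) λ c → Σ (Fin (n G) → Fin (n G) → Fin k) λ e → IsTotalColoring G k c e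

χ≤ : Graph → ℕ → Set
χ≤ G m = Σ ℕ λ k → k ≤ m × VertexColorable G k

χ′≡ : Graph → ℕ → Set
χ′≡ G m = EdgeColorable G m × (∀ k → EdgeColorable G k → m ≤ k)

χ″≤ : Graph → ℕ → Set
χ″≤ G m = Σ ℕ λ k → k ≤ m × TotalColorable G k

-- Reserve four colours for a proper vertex colouring c and keep the edge
-- colours 2, …, Δ − 1 of a Δ-edge-colouring. The edges of colours 0 and 1 form
-- two matchings, whose union is a disjoint union of paths and even cycles; they
-- are recoloured with the four vertex colours, each edge avoiding the colours
-- of its ends and of the adjacent edges of the other matching. If at every
-- vertex the two neighbours across the matchings have the same colour, an edge
-- uv takes the smaller or the larger colour outside {c u, c v} according to its
-- matching. Otherwise, at a vertex x whose neighbours a, b have different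
-- colours, delete xb and colour the path that now starts at x edge by edge,
-- prescribing colour c b for xa; a colour for xb then remains. For Δ ≤ 1 the graph is a matching and
-- three colours suffice directly.
module Submission where

open import Defs renaming (sym to adj-sym)
open import Data.Bool using (true)
open import Data.Bool.Properties using () renaming (_≟_ to _≟ᵇ_)
open import Data.Empty using (⊥-elim)
open import Data.Fin using (Fin; zero; suc; inject≤; splitAt; join)
  renaming (_<_ to _<ᶠ_)
open import Data.Fin.Properties
  using (_≟_; all?; any?; ¬Fin0; inject≤-injective; splitAt-join; join-splitAt; <-cmp)
  renaming (_<?_ to _<ᶠ?_; <-asym to <ᶠ-asym)
open import Data.Nat using (ℕ; zero; suc; _+_; _≤_; _<_; z≤n; s≤s)
open import Data.Nat.Induction using (<-wellFounded)
open import Data.Nat.Properties using (≤-refl; ≤-reflexive; +-comm; +-mono-≤; +-mono-<-≤; +-mono-≤-<)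
open import Data.Product using (∃; ∃-syntax; _×_; _,_; proj₁; proj₂)
open import Data.Sum using (_⊎_; inj₁; inj₂; map₁)
open import Data.Sum.Properties using (inj₁-injective; inj₂-injective; ≡-dec)
open import Function using (_∘_; case_of_)
open import Induction.WellFounded using (Acc; acc)
open import Relation.Binary.Definitions using (tri<; tri≈; tri>)
open import Relation.Binary.PropositionalEquality
  using (_≡_; _≢_; refl; sym; trans; cong; subst; ≢-sym)
open import Relation.Nullary using (¬_; Dec; yes; no)
open import Relation.Nullary.Decidable using (from-yes; decidable-stable; ¬?; _×-dec_; _⊎-dec_)

-- Opaque, so that unification never unfolds the exhaustive search.
opaque
  fresh-exists : (i j k : Fin 4) → ∃[ γ ] γ ≢ i × γ ≢ j × γ ≢ k
  fresh-exists = from-yes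
    (all? λ (i : Fin 4) → all? λ (j : Fin 4) → all? λ (k : Fin 4) →
       any? λ (γ : Fin 4) → ¬? (γ ≟ i) ×-dec ¬? (γ ≟ j) ×-dec ¬? (γ ≟ k))

  fresh : Fin 4 → Fin 4 → Fin 4 → Fin 4
  fresh i j k = proj₁ (fresh-exists i j k)

  fresh-≢₁ : ∀ i j k → fresh i j k ≢ i
  fresh-≢₁ i j k = proj₁ (proj₂ (fresh-exists i j k))

  fresh-≢₂ : ∀ i j k → fresh i j k ≢ j
  fresh-≢₂ i j k = proj₁ (proj₂ (proj₂ (fresh-exists i j k)))

  fresh-≢₃ : ∀ i j k → fresh i j k ≢ k
  fresh-≢₃ i j k = proj₂ (proj₂ (proj₂ (fresh-exists i j k)))

-- The smaller and the larger of the two colours outside {i, j}; as they only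
-- depend on the set {i, j}, they are symmetric in i and j.
low high : Fin 4 → Fin 4 → Fin 4
low i j = fresh i j i
high i j = fresh i j (low i j)

opaque
  unfolding fresh

  low-sym : ∀ i j → low i j ≡ low j i
  low-sym = from-yes (all? λ (i : Fin 4) → all? λ (j : Fin 4) → low i j ≟ low j i)

  high-sym : ∀ i j → high i j ≡ high j i
  high-sym = from-yes (all? λ (i : Fin 4) → all? λ (j : Fin 4) → high i j ≟ high j i)

low≢high : ∀ i j → low i j ≢ high i j
low≢high i j = ≢-sym (fresh-≢₃ i j (low i j))

two-valued : {a b c : Fin 2} → a ≢ b → c ≢ b → a ≡ c
two-valued {zero}     {_}        {zero}     _   _   = refl
two-valued {suc zero} {_}        {suc zero} _   _   = refl
two-valued {zero}     {zero}     {suc zero} a≢b _   = ⊥-elim (a≢b refl)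
two-valued {zero}     {suc zero} {suc zero} _   c≢b = ⊥-elim (c≢b refl)
two-valued {suc zero} {zero}     {zero}     _   c≢b = ⊥-elim (c≢b refl)
two-valued {suc zero} {suc zero} {zero}     a≢b _   = ⊥-elim (a≢b refl)

∑ : ∀ {m} → (Fin m → ℕ) → ℕ
∑ {zero}  f = 0
∑ {suc m} f = f zero + ∑ (f ∘ suc)

∑-mono-≤ : ∀ {m} {f g : Fin m → ℕ} → (∀ i → f i ≤ g i) → ∑ f ≤ ∑ g
∑-mono-≤ {zero}  f≤g = z≤n
∑-mono-≤ {suc m} f≤g = +-mono-≤ (f≤g zero) (∑-mono-≤ (f≤g ∘ suc))

∑-mono-< : ∀ {m} {f g : Fin m → ℕ} → (∀ i → f i ≤ g i) → ∀ i → f i < g i → ∑ f < ∑ g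
∑-mono-< f≤g zero    fi<gi = +-mono-<-≤ fi<gi (∑-mono-≤ (f≤g ∘ suc))
∑-mono-< f≤g (suc i) fi<gi = +-mono-≤-< (f≤g zero) (∑-mono-< (f≤g ∘ suc) i fi<gi)

indicator : ∀ {A : Set} → Dec A → ℕ
indicator (yes _) = 1
indicator (no _)  = 0

indicator-mono-≤ : ∀ {A B : Set} → (A → B) → (a? : Dec A) (b? : Dec B) → indicator a? ≤ indicator b?
indicator-mono-≤ _   (yes _) (yes _) = ≤-refl
indicator-mono-≤ A→B (yes a) (no ¬b) = ⊥-elim (¬b (A→B a))
indicator-mono-≤ _   (no _)  _       = z≤n

indicator-< : ∀ {A B : Set} → ¬ A → B → (a? : Dec A) (b? : Dec B) → indicator a? < indicator b?
indicator-< ¬a b (yes a) _       = ⊥-elim (¬a a)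
indicator-< ¬a b (no _)  (yes _) = s≤s z≤n
indicator-< ¬a b (no _)  (no ¬b) = ⊥-elim (¬b b)

join-injective : ∀ m n {i j : Fin m ⊎ Fin n} → join m n i ≡ join m n j → i ≡ j
join-injective m n {i} {j} eq =
  trans (sym (splitAt-join m n i)) (trans (cong (splitAt m) eq) (splitAt-join m n j))

splitAt-injective : ∀ m {n} {i j : Fin (m + n)} → splitAt m i ≡ splitAt m j → i ≡ j
splitAt-injective m {n} {i} {j} eq =
  trans (sym (join-splitAt m n i)) (trans (cong (join m n) eq) (join-splitAt m n j))

Adj-sym : ∀ G {u v} → Adj G u v → Adj G v u
Adj-sym G {u} {v} uv = trans (sym (adj-sym G u v)) uv

VertexColorable-mono : ∀ G {k k′} → k ≤ k′ → VertexColorable G k → VertexColorable G k′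
VertexColorable-mono G k≤k′ (c , proper) =
  (λ u → inject≤ (c u) k≤k′) ,
  λ u v uv eq → proper u v uv (inject≤-injective k≤k′ k≤k′ (c u) (c v) eq)

-- Two disjoint matchings, labelled by Fin 2, whose edges are to be recoloured
-- with the four colours of the vertex colouring c.
module TwoMatchings {n : ℕ} (c : Fin n → Fin 4) where

  record MatchingPair : Set₁ where
    field
      Edge         : Fin 2 → Fin n → Fin n → Set
      edge?        : ∀ ℓ u v → Dec (Edge ℓ u v)
      edge-sym     : ∀ {ℓ u v} → Edge ℓ u v → Edge ℓ v u
      edge-proper  : ∀ {ℓ u v} → Edge ℓ u v → c u ≢ c v
      matching     : ∀ {ℓ u v w} → Edge ℓ u v → Edge ℓ u w → v ≡ w
      single-label : ∀ {ℓ ℓ′ u v} → Edge ℓ u v → Edge ℓ′ u v → ℓ ≡ ℓ′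

  open MatchingPair

  OtherEdge : MatchingPair → Fin 2 → Fin n → Fin n → Set
  OtherEdge M ℓ u w = ∃[ ℓ′ ] ℓ′ ≢ ℓ × Edge M ℓ′ u w

  otherEdge? : ∀ M ℓ u w → Dec (OtherEdge M ℓ u w)
  otherEdge? M ℓ u w = any? λ ℓ′ → ¬? (ℓ′ ≟ ℓ) ×-dec edge? M ℓ′ u w

  otherEdge-unique : ∀ M {ℓ u v w} → OtherEdge M ℓ u v → OtherEdge M ℓ u w → v ≡ w
  otherEdge-unique M (_ , ℓ₁≢ℓ , uv) (_ , ℓ₂≢ℓ , uw) =
    matching M uv (subst (λ ℓ′ → Edge M ℓ′ _ _) (sym (two-valued ℓ₁≢ℓ ℓ₂≢ℓ)) uw)

  otherEdge⇒edge : ∀ M {ℓ ℓ′ u v} → ℓ′ ≢ ℓ → OtherEdge M ℓ′ u v → Edge M ℓ u v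
  otherEdge⇒edge M ℓ′≢ℓ (_ , ℓ″≢ℓ′ , e) =
    subst (λ ℓ → Edge M ℓ _ _) (two-valued ℓ″≢ℓ′ (≢-sym ℓ′≢ℓ)) e

  record Admissible (M : MatchingPair) (g : Fin n → Fin n → Fin 4) : Set where
    field
      symmetric : ∀ {ℓ u v} → Edge M ℓ u v → g u v ≡ g v u
      avoids    : ∀ {ℓ u v} → Edge M ℓ u v → g u v ≢ c u
      separates : ∀ {ℓ u v w} → Edge M ℓ u v → OtherEdge M ℓ u w → g u v ≢ g u w

  Colouring : MatchingPair → Set
  Colouring M = ∃ (Admissible M)

  Mixed : MatchingPair → Set
  Mixed M = ∃[ x ] ∃[ a ] ∃[ b ] ∃[ ℓ ] Edge M ℓ x a × OtherEdge M ℓ x b × c a ≢ c b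

  mixed? : ∀ M → Dec (Mixed M)
  mixed? M = any? λ x → any? λ a → any? λ b → any? λ ℓ →
    edge? M ℓ x a ×-dec otherEdge? M ℓ x b ×-dec ¬? (c a ≟ c b)

  lowHigh : MatchingPair → Fin n → Fin n → Fin 4
  lowHigh M u v with edge? M zero u v
  ... | yes _ = low (c u) (c v)
  ... | no  _ = high (c u) (c v)

  lowHigh-admissible : ∀ M → ¬ Mixed M → Admissible M (lowHigh M)
  lowHigh-admissible M unmixed = record
    { symmetric = symmetric ; avoids = avoids ; separates = separates }
    where
    symmetric : ∀ {ℓ u v} → Edge M ℓ u v → lowHigh M u v ≡ lowHigh M v u
    symmetric {u = u} {v} _ with edge? M zero u v | edge? M zero v u
    ... | yes _  | yes _  = low-sym (c u) (c v)
    ... | no  _  | no  _  = high-sym (c u) (c v)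
    ... | yes uv | no ¬vu = ⊥-elim (¬vu (edge-sym M uv))
    ... | no ¬uv | yes vu = ⊥-elim (¬uv (edge-sym M vu))

    avoids : ∀ {ℓ u v} → Edge M ℓ u v → lowHigh M u v ≢ c u
    avoids {u = u} {v} _ with edge? M zero u v
    ... | yes _ = fresh-≢₁ (c u) (c v) _
    ... | no  _ = fresh-≢₁ (c u) (c v) _

    same-colour : ∀ {ℓ u v w} → Edge M ℓ u v → OtherEdge M ℓ u w → c v ≡ c w
    same-colour uv uw = decidable-stable (c _ ≟ c _) λ cv≢cw → unmixed (_ , _ , _ , _ , uv , uw , cv≢cw)

    separates : ∀ {ℓ u v w} → Edge M ℓ u v → OtherEdge M ℓ u w → lowHigh M u v ≢ lowHigh M u w
    separates {ℓ} {u} {v} {w} uv o@(ℓ′ , ℓ′≢ℓ , uw) with edge? M zero u v | edge? M zero u w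
    ... | yes uv₀ | yes uw₀ =
      ⊥-elim (ℓ′≢ℓ (trans (single-label M uw uw₀) (sym (single-label M uv uv₀))))
    ... | yes _ | no _ = λ eq → low≢high (c u) (c v) (trans eq (cong (high (c u)) (sym (same-colour uv o))))
    ... | no _ | yes _ = λ eq → low≢high (c u) (c w) (trans (sym eq) (cong (high (c u)) (same-colour uv o)))
    ... | no ¬uv₀ | no ¬uw₀ =
      ⊥-elim (ℓ′≢ℓ (two-valued {ℓ′} {zero} {ℓ} (λ { refl → ¬uw₀ uw })
                                               (λ { refl → ¬uv₀ uv })))

  SamePair : Fin n → Fin n → Fin n → Fin n → Set
  SamePair x y u v = (u ≡ x × v ≡ y) ⊎ (u ≡ y × v ≡ x)

  samePair? : ∀ x y u v → Dec (SamePair x y u v)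
  samePair? x y u v = ((u ≟ x) ×-dec (v ≟ y)) ⊎-dec ((u ≟ y) ×-dec (v ≟ x))

  samePair-sym : ∀ {x y u v} → SamePair x y u v → SamePair x y v u
  samePair-sym (inj₁ (u≡x , v≡y)) = inj₂ (v≡y , u≡x)
  samePair-sym (inj₂ (u≡y , v≡x)) = inj₁ (v≡x , u≡y)

  samePair-edge : ∀ M {ℓ x y u v} → SamePair x y u v → Edge M ℓ u v → Edge M ℓ x y
  samePair-edge M (inj₁ (refl , refl)) e = e
  samePair-edge M (inj₂ (refl , refl)) e = edge-sym M e

  samePair-unique : ∀ {x y u v w} → x ≢ y → SamePair x y u v → SamePair x y u w → v ≡ w
  samePair-unique _   (inj₁ (_ , refl)) (inj₁ (_ , refl)) = refl
  samePair-unique _   (inj₂ (_ , refl)) (inj₂ (_ , refl)) = refl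
  samePair-unique x≢y (inj₁ (refl , _)) (inj₂ (u≡y , _)) = ⊥-elim (x≢y u≡y)
  samePair-unique x≢y (inj₂ (refl , _)) (inj₁ (u≡x , _)) = ⊥-elim (x≢y (sym u≡x))

  delete : MatchingPair → Fin 2 → Fin n → Fin n → MatchingPair
  delete M ℓ₀ x y = record
    { Edge         = λ ℓ u v → Edge M ℓ u v × ¬ (ℓ ≡ ℓ₀ × SamePair x y u v)
    ; edge?        = λ ℓ u v → edge? M ℓ u v ×-dec ¬? ((ℓ ≟ ℓ₀) ×-dec samePair? x y u v)
    ; edge-sym     = λ (e , kept) → edge-sym M e , λ (ℓ≡ℓ₀ , p) → kept (ℓ≡ℓ₀ , samePair-sym p)
    ; edge-proper  = edge-proper M ∘ proj₁
    ; matching     = λ e e′ → matching M (proj₁ e) (proj₁ e′)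
    ; single-label = λ e e′ → single-label M (proj₁ e) (proj₁ e′)
    }

  delete-keeps : ∀ M {ℓ₀ x y ℓ u v} → ℓ ≢ ℓ₀ → Edge M ℓ u v → Edge (delete M ℓ₀ x y) ℓ u v
  delete-keeps M ℓ≢ℓ₀ e = e , ℓ≢ℓ₀ ∘ proj₁

  deleted-at-x : ∀ M {ℓ x y w} → Edge M ℓ x y → ¬ Edge (delete M ℓ x y) ℓ x w
  deleted-at-x M xy (xw , kept) = kept (refl , inj₁ (refl , matching M xw xy))

  deleted-at-y : ∀ M {ℓ x y w} → Edge M ℓ x y → ¬ Edge (delete M ℓ x y) ℓ y w
  deleted-at-y M xy (yw , kept) = kept (refl , inj₂ (refl , matching M yw (edge-sym M xy)))

  size : MatchingPair → ℕ
  size M = ∑ λ ℓ → ∑ λ u → ∑ λ v → indicator (edge? M ℓ u v)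

  size-< : ∀ M M′ {ℓ x y} → (∀ {ℓ u v} → Edge M′ ℓ u v → Edge M ℓ u v) →
           ¬ Edge M′ ℓ x y → Edge M ℓ x y → size M′ < size M
  size-< M M′ {ℓ} {x} {y} M′⊆M ¬xy xy =
    ∑-mono-< (λ ℓ′ → ∑-mono-≤ λ u → ∑-mono-≤ λ v → pointwise ℓ′ u v) ℓ
      (∑-mono-< (λ u → ∑-mono-≤ λ v → pointwise ℓ u v) x
        (∑-mono-< (λ v → pointwise ℓ x v) y (indicator-< ¬xy xy _ _)))
    where
    pointwise : ∀ ℓ u v → indicator (edge? M′ ℓ u v) ≤ indicator (edge? M ℓ u v)
    pointwise ℓ u v = indicator-mono-≤ M′⊆M _ _

  size-delete : ∀ M {ℓ x y} → Edge M ℓ x y → size (delete M ℓ x y) < size M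
  size-delete M xy = size-< M (delete M _ _ _) proj₁ (deleted-at-x M xy) xy

  _[_,_≔_] : (Fin n → Fin n → Fin 4) → Fin n → Fin n → Fin 4 → Fin n → Fin n → Fin 4
  (g [ x , y ≔ γ ]) u v with samePair? x y u v
  ... | yes _ = γ
  ... | no  _ = g u v

  update-here : ∀ g x y γ → (g [ x , y ≔ γ ]) x y ≡ γ
  update-here g x y γ with samePair? x y x y
  ... | yes _  = refl
  ... | no ¬xy = ⊥-elim (¬xy (inj₁ (refl , refl)))

  extend : ∀ M {ℓ x y g γ} → Edge M ℓ x y → Admissible (delete M ℓ x y) g →
           γ ≢ c x → γ ≢ c y →
           (∀ {w} → OtherEdge M ℓ x w → γ ≢ g x w) →
           (∀ {w} → OtherEdge M ℓ y w → γ ≢ g y w) →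
           Admissible M (g [ x , y ≔ γ ])
  extend M {ℓ} {x} {y} {g} {γ} xy adm γ≢cx γ≢cy fresh-x fresh-y = record
    { symmetric = symmetric′ ; avoids = avoids′ ; separates = separates′ }
    where
    open Admissible adm

    kept : ∀ {ℓ′ u v} → Edge M ℓ′ u v → ¬ SamePair x y u v → Edge (delete M ℓ x y) ℓ′ u v
    kept e ¬p = e , ¬p ∘ proj₂

    at-pair : ∀ {ℓ′ u v w} → SamePair x y u v → Edge M ℓ′ u v → OtherEdge M ℓ′ u w → γ ≢ g u w
    at-pair p uv o with single-label M (samePair-edge M p uv) xy
    at-pair (inj₁ (refl , _)) _ o | refl = fresh-x o
    at-pair (inj₂ (refl , _)) _ o | refl = fresh-y o

    symmetric′ : ∀ {ℓ′ u v} → Edge M ℓ′ u v → (g [ x , y ≔ γ ]) u v ≡ (g [ x , y ≔ γ ]) v u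
    symmetric′ {u = u} {v} uv with samePair? x y u v | samePair? x y v u
    ... | yes _  | yes _  = refl
    ... | yes p  | no ¬q  = ⊥-elim (¬q (samePair-sym p))
    ... | no ¬p  | yes q  = ⊥-elim (¬p (samePair-sym q))
    ... | no ¬p  | no _   = symmetric (kept uv ¬p)

    avoids′ : ∀ {ℓ′ u v} → Edge M ℓ′ u v → (g [ x , y ≔ γ ]) u v ≢ c u
    avoids′ {u = u} {v} uv with samePair? x y u v
    ... | yes (inj₁ (refl , _)) = γ≢cx
    ... | yes (inj₂ (refl , _)) = γ≢cy
    ... | no ¬p                 = avoids (kept uv ¬p)

    separates′ : ∀ {ℓ′ u v w} → Edge M ℓ′ u v → OtherEdge M ℓ′ u w →
                 (g [ x , y ≔ γ ]) u v ≢ (g [ x , y ≔ γ ]) u w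
    separates′ {u = u} {v} {w} uv o@(ℓ″ , ℓ″≢ℓ′ , uw) with samePair? x y u v | samePair? x y u w
    ... | yes p | yes q =
      ⊥-elim (ℓ″≢ℓ′ (single-label M uw (subst (Edge M _ u) (samePair-unique x≢y p q) uv)))
      where x≢y : x ≢ y
            x≢y = edge-proper M xy ∘ cong c
    ... | yes p | no _  = at-pair p uv o
    ... | no _  | yes q = ≢-sym (at-pair q uw (_ , ≢-sym ℓ″≢ℓ′ , uv))
    ... | no ¬p | no ¬q = separates (kept uv ¬p) (ℓ″ , ℓ″≢ℓ′ , kept uw ¬q)

  fresh-at : ∀ M (g : Fin n → Fin n → Fin 4) ℓ u (i j : Fin 4) →
             ∃[ γ ] γ ≢ i × γ ≢ j × (∀ {w} → OtherEdge M ℓ u w → γ ≢ g u w)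
  fresh-at M g ℓ u i j with any? (otherEdge? M ℓ u)
  ... | yes (w , o) = fresh i j (g u w) , fresh-≢₁ i j (g u w) , fresh-≢₂ i j (g u w) ,
        λ o′ eq → fresh-≢₃ i j (g u w) (trans eq (cong (g u) (sym (otherEdge-unique M o o′))))
  ... | no none = fresh i j i , fresh-≢₁ i j i , fresh-≢₂ i j i , λ o′ → ⊥-elim (none (_ , o′))

  PathColouring : MatchingPair → Fin n → Fin n → Fin 4 → Set
  PathColouring M x a γ = ∃[ g ] Admissible M g × g x a ≡ γ

  resolve-mixed : ∀ M {x a b ℓ ℓ′} → Edge M ℓ x a → Edge M ℓ′ x b → ℓ′ ≢ ℓ →
                  PathColouring (delete M ℓ′ x b) x a (c b) → Colouring M
  resolve-mixed M {x} {a} {b} {ℓ} {ℓ′} xa xb ℓ′≢ℓ (g , adm , gxa≡cb)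
    with fresh-at M g ℓ′ b (c x) (c b)
  ... | γ , γ≢cx , γ≢cb , fresh-b =
    g [ x , b ≔ γ ] , extend M xb adm γ≢cx γ≢cb fresh-x fresh-b
    where
    fresh-x : ∀ {w} → OtherEdge M ℓ′ x w → γ ≢ g x w
    fresh-x o eq =
      γ≢cb (trans eq (trans (cong (g x) (otherEdge-unique M o (ℓ , ≢-sym ℓ′≢ℓ , xa))) gxa≡cb))

  path-ends : ∀ M {ℓ x a γ} → Edge M ℓ x a →
              (∀ {w} → ¬ OtherEdge M ℓ x w) → (∀ {w} → ¬ OtherEdge M ℓ a w) →
              γ ≢ c x → γ ≢ c a →
              Colouring (delete M ℓ x a) → PathColouring M x a γ
  path-ends M {x = x} {a} {γ} xa x-end a-end γ≢cx γ≢ca (g , adm) =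
    g [ x , a ≔ γ ] , extend M xa adm γ≢cx γ≢ca (⊥-elim ∘ x-end) (⊥-elim ∘ a-end) ,
    update-here g x a γ

  path-continues : ∀ M {ℓ x a w γ} → Edge M ℓ x a → (∀ {v} → ¬ OtherEdge M ℓ x v) →
                   OtherEdge M ℓ a w → γ ≢ c x → γ ≢ c a →
                   PathColouring (delete M ℓ x a) a w (fresh (c a) (c w) γ) → PathColouring M x a γ
  path-continues M {x = x} {a} {w} {γ} xa x-end aw γ≢cx γ≢ca (g , adm , gaw) =
    g [ x , a ≔ γ ] , extend M xa adm γ≢cx γ≢ca (⊥-elim ∘ x-end) fresh-a , update-here g x a γ
    where
    fresh-a : ∀ {v} → OtherEdge M _ a v → γ ≢ g a v
    fresh-a o eq =
      fresh-≢₃ (c a) (c w) γ (trans (sym gaw) (trans (cong (g a) (otherEdge-unique M aw o)) (sym eq)))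

  -- In colour-path, x is an end of the path through xa in the union of the
  -- two matchings.
  mutual
    colour : ∀ M → Acc _<_ (size M) → Colouring M
    colour M (acc rs) with mixed? M
    ... | no unmixed = lowHigh M , lowHigh-admissible M unmixed
    ... | yes (x , a , b , ℓ , xa , (ℓ′ , ℓ′≢ℓ , xb) , ca≢cb) =
      resolve-mixed M xa xb ℓ′≢ℓ
        (colour-path M′ (rs (size-delete M xb)) (delete-keeps M (≢-sym ℓ′≢ℓ) xa)
          (deleted-at-x M xb ∘ otherEdge⇒edge M′ (≢-sym ℓ′≢ℓ))
          (c b) (≢-sym (edge-proper M xb)) (≢-sym ca≢cb))
      where M′ = delete M ℓ′ x b

    colour-path : ∀ M → Acc _<_ (size M) →
                  ∀ {ℓ x a} → Edge M ℓ x a → (∀ {w} → ¬ OtherEdge M ℓ x w) →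
                  ∀ γ → γ ≢ c x → γ ≢ c a → PathColouring M x a γ
    colour-path M (acc rs) {ℓ} {x} {a} xa x-end γ γ≢cx γ≢ca with any? (otherEdge? M ℓ a)
    ... | no a-end =
      path-ends M xa x-end (a-end ∘ (_ ,_)) γ≢cx γ≢ca (colour M′ (rs (size-delete M xa)))
      where M′ = delete M ℓ x a
    ... | yes (w , aw@(ℓ′ , ℓ′≢ℓ , e)) =
      path-continues M xa x-end aw γ≢cx γ≢ca
        (colour-path M′ (rs (size-delete M xa)) (delete-keeps M ℓ′≢ℓ e)
          (deleted-at-y M xa ∘ otherEdge⇒edge M′ ℓ′≢ℓ)
          (fresh (c a) (c w) γ) (fresh-≢₁ _ _ _) (fresh-≢₂ _ _ _))
      where M′ = delete M ℓ x a

  colouring : ∀ M → Colouring M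
  colouring M = colour M (<-wellFounded (size M))

module FromEdgeColouring (G : Graph) (m : ℕ)
  (c : Fin (n G) → Fin 4) (c-proper : IsVertexColoring G 4 c)
  (e : Fin (n G) → Fin (n G) → Fin (2 + m)) (e-proper : IsEdgeColoring G (2 + m) e) where

  open TwoMatchings c

  layer : Fin (n G) → Fin (n G) → Fin 2 ⊎ Fin m
  layer u v = splitAt 2 (e u v)

  layer-sym : ∀ {u v} → Adj G u v → layer u v ≡ layer v u
  layer-sym {u} {v} uv = cong (splitAt 2) (proj₁ e-proper u v uv)

  same-layer : ∀ {u v w} → Adj G u v → Adj G u w → v ≢ w → layer u v ≢ layer u w
  same-layer {u} {v} {w} uv uw v≢w = proj₂ e-proper u v w uv uw v≢w ∘ splitAt-injective 2

  M : MatchingPair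
  M = record
    { Edge         = λ ℓ u v → Adj G u v × layer u v ≡ inj₁ ℓ
    ; edge?        = λ ℓ u v → (adj G u v ≟ᵇ true) ×-dec ≡-dec _≟_ _≟_ (layer u v) (inj₁ ℓ)
    ; edge-sym     = λ (uv , l) → Adj-sym G uv , trans (sym (layer-sym uv)) l
    ; edge-proper  = λ (uv , _) → c-proper _ _ uv
    ; matching     = λ {_} {u} {v} {w} (uv , l) (uw , l′) →
                       decidable-stable (v ≟ w) λ v≢w → same-layer uv uw v≢w (trans l (sym l′))
    ; single-label = λ (_ , l) (_ , l′) → inj₁-injective (trans (sym l) l′)
    }

  g : Fin (n G) → Fin (n G) → Fin 4
  g = proj₁ (colouring M)

  open Admissible (proj₂ (colouring M))

  vertexColour : Fin (n G) → Fin (4 + m)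
  vertexColour u = join 4 m (inj₁ (c u))

  edgeColour : Fin (n G) → Fin (n G) → Fin (4 + m)
  edgeColour u v = join 4 m (map₁ (λ _ → g u v) (layer u v))

  edgeColour-sym : ∀ u v → Adj G u v → edgeColour u v ≡ edgeColour v u
  edgeColour-sym u v uv with layer u v in l | layer v u in l′
  ... | inj₁ _ | inj₁ _ = cong (join 4 m ∘ inj₁) (symmetric (uv , l))
  ... | inj₂ _ | inj₂ _ =
    cong (join 4 m ∘ inj₂) (inj₂-injective (trans (sym l) (trans (layer-sym uv) l′)))
  ... | inj₁ _ | inj₂ _ = case trans (sym l) (trans (layer-sym uv) l′) of λ ()
  ... | inj₂ _ | inj₁ _ = case trans (sym l) (trans (layer-sym uv) l′) of λ ()

  edgeColour-proper : ∀ u v w → Adj G u v → Adj G u w → v ≢ w → edgeColour u v ≢ edgeColour u w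
  edgeColour-proper u v w uv uw v≢w with layer u v in l | layer u w in l′
  ... | inj₁ ℓ | inj₁ ℓ′ with ℓ′ ≟ ℓ
  ...   | yes refl  = ⊥-elim (same-layer uv uw v≢w (trans l (sym l′)))
  ...   | no ℓ′≢ℓ   = separates (uv , l) (ℓ′ , ℓ′≢ℓ , uw , l′) ∘ inj₁-injective ∘ join-injective 4 m
  edgeColour-proper u v w uv uw v≢w | inj₂ j | inj₂ j′ =
    same-layer uv uw v≢w ∘ (λ eq → trans l (trans (cong inj₂ eq) (sym l′))) ∘
    inj₂-injective ∘ join-injective 4 m
  edgeColour-proper u v w uv uw v≢w | inj₁ _ | inj₂ j =
    λ eq → case join-injective 4 m {inj₁ (g u v)} {inj₂ j} eq of λ ()
  edgeColour-proper u v w uv uw v≢w | inj₂ j | inj₁ _ =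
    λ eq → case join-injective 4 m {inj₂ j} {inj₁ (g u w)} eq of λ ()

  vertexColour≢edgeColour : ∀ u v → Adj G u v → vertexColour u ≢ edgeColour u v
  vertexColour≢edgeColour u v uv with layer u v in l
  ... | inj₁ _ = avoids (uv , l) ∘ sym ∘ inj₁-injective ∘ join-injective 4 m
  ... | inj₂ j = λ eq → case join-injective 4 m {inj₁ (c u)} {inj₂ j} eq of λ ()

  total : TotalColorable G (4 + m)
  total = vertexColour , edgeColour ,
    (λ u v uv → c-proper u v uv ∘ inj₁-injective ∘ join-injective 4 m) ,
    (edgeColour-sym , edgeColour-proper) ,
    vertexColour≢edgeColour

-- An edge colouring assigns a colour to every pair of vertices, so one with
-- no colours forces an empty vertex set.
edgeless-total : ∀ G → EdgeColorable G 0 → TotalColorable G 1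
edgeless-total G (e , _) =
  (λ _ → zero) , (λ _ _ → zero) , (λ u v _ _ → ¬Fin0 (e u v)) ,
  ((λ u v _ → ⊥-elim (¬Fin0 (e u v))) , (λ u v _ _ _ _ _ → ¬Fin0 (e u v))) ,
  (λ u v _ _ → ¬Fin0 (e u v))

-- The smaller end of each edge gets colour 0, the larger 1, all edges 2.
matching-total : ∀ G → EdgeColorable G 1 → TotalColorable G 3
matching-total G (e , _ , e-proper) =
  colour , (λ _ _ → suc (suc zero)) , colour-proper ,
  ((λ _ _ _ → refl) , (λ u v w uv uw v≢w _ → v≢w (unique-neighbour uv uw))) ,
  (λ u _ _ → colour≢2 u)
  where
  single-colour : (i j : Fin 1) → i ≡ j
  single-colour zero zero = refl

  unique-neighbour : ∀ {u v w} → Adj G u v → Adj G u w → v ≡ w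
  unique-neighbour {u} {v} {w} uv uw = decidable-stable (v ≟ w) λ v≢w →
    e-proper u v w uv uw v≢w (single-colour (e u v) (e u w))

  lower-neighbour? : ∀ u → Dec (∃[ v ] v <ᶠ u × Adj G u v)
  lower-neighbour? u = any? λ v → (v <ᶠ? u) ×-dec (adj G u v ≟ᵇ true)

  colour : Fin (n G) → Fin 3
  colour u with lower-neighbour? u
  ... | yes _ = suc zero
  ... | no  _ = zero

  colour≢2 : ∀ u → colour u ≢ suc (suc zero)
  colour≢2 u with lower-neighbour? u
  ... | yes _ = λ ()
  ... | no  _ = λ ()

  colour-upper : ∀ {u v} → Adj G u v → u <ᶠ v → colour v ≡ suc zero
  colour-upper {u} {v} uv u<v with lower-neighbour? v
  ... | yes _   = refl
  ... | no none = ⊥-elim (none (u , u<v , Adj-sym G uv))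

  colour-lower : ∀ {u v} → Adj G u v → u <ᶠ v → colour u ≡ zero
  colour-lower {u} {v} uv u<v with lower-neighbour? u
  ... | no _               = refl
  ... | yes (w , w<u , uw) = ⊥-elim (<ᶠ-asym u<v (subst (_<ᶠ u) (unique-neighbour uw uv) w<u))

  colour-proper : IsVertexColoring G 3 colour
  colour-proper u v uv eq with <-cmp u v
  ... | tri< u<v _ _ = case trans (sym (colour-lower uv u<v)) (trans eq (colour-upper uv u<v)) of λ ()
  ... | tri> _ _ v<u =
    case trans (sym (colour-upper (Adj-sym G uv) v<u)) (trans eq (colour-lower (Adj-sym G uv) v<u)) of λ ()
  ... | tri≈ _ refl _ = case trans (sym (irrefl G u)) uv of λ ()

χ″≤-+2 : ∀ G → VertexColorable G 4 → ∀ D → EdgeColorable G D → χ″≤ G (D + 2)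
χ″≤-+2 G _ zero          ec = 1 , s≤s z≤n , edgeless-total G ec
χ″≤-+2 G _ (suc zero)    ec = 3 , ≤-refl , matching-total G ec
χ″≤-+2 G (c , c-proper) (suc (suc m)) (e , e-proper) =
  4 + m , ≤-reflexive (sym (+-comm (2 + m) 2)) , FromEdgeColouring.total G m c c-proper e e-proper

theorem4p3 : (G : Graph) → χ≤ G 4 → χ′≡ G (Δ G) → χ″≤ G (Δ G + 2)
theorem4p3 G (_ , k≤4 , vc) (ec , _) = χ″≤-+2 G (VertexColorable-mono G k≤4 vc) (Δ G) ec
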